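{- In the setting below, if $\rho\equiv\rho'$ are rotor configurations, then $\tau\rho\equiv\tau\rho'$ for every particle configuration $\tau$.
   Context: $G=(V,E)$ is a finite strongly connected directed graph, $T\subseteq V$ a nonempty set of targets, $V_0=V\setminus T$, $d(v)$ the out-degree. At each $v\in V_0$ a rotor mechanism is fixed: an ordering $e_v^1,\dots,e_v^{d(v)}$ of the arcs leaving $v$, extended periodically; for $e=e_v^i$ put $e^+=e_v^{i+1}$. A rotor configuration is a map $\rho:V_0\to E$ with $\rho(v)$ an arc leaving $v$. A particle at $v\in V_0$ steps by replacing $\rho(v)$ with $\rho(v)^+$ and moving along the new $\rho(v)$; particles stop on reaching $T$. A particle configuration is a map $\sigma:V_0\to\mathbb{N}$; $\sigma\rho$ is the rotor configuration obtained by placing $\sigma(v)$ particles at each $v$ and letting all step until each reaches $T$ (independent of the order of steps). $\rho\equiv\rho'$ means $\sigma\rho=\sigma\rho'$ for some particle configuration $\sigma$. -}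

module Defs where

open import Data.Nat using (ℕ; zero; suc; _+_; _∸_)
open import Data.Nat.DivMod using (_%_; m%n<n)
open import Data.Fin using (Fin; toℕ; fromℕ<)
open import Data.Fin.Properties using (_≟_)
open import Data.Bool using (Bool; true; false)
open import Data.Product using (Σ; ∃; ∃-syntax; _×_; _,_)
open import Relation.Nullary using (yes; no)
open import Relation.Binary.PropositionalEquality using (_≡_; refl)
open import Relation.Binary.Construct.Closure.ReflexiveTransitive using (Star)

-- Cyclic successor on Fin d : the periodic extension of a rotor order
-- (index i ↦ i+1, and the last index ↦ the first).
next : ∀ {d} → Fin d → Fin d
next {suc d} i = fromℕ< (m%n<n (suc (toℕ i)) (suc d))

-- A finite directed graph on vertex set Fin n together with a rotor
-- mechanism: vertex v has out-degree d v, and its outgoing arcs in rotor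
-- order are e_v^1,...,e_v^{d v}, where arc e_v^{i+1} goes from v to nbr v i.
-- Arcs are pairs (v , nbr v i); E ⊆ V × V is encoded by injectivity of nbr v.
record RotorGraph : Set where
  field
    n   : ℕ
    d   : Fin n → ℕ
    nbr : (v : Fin n) → Fin (d v) → Fin n
    nbr-injective : ∀ v (i j : Fin (d v)) → nbr v i ≡ nbr v j → i ≡ j

module _ (G : RotorGraph) where
  open RotorGraph G

  Arc : Fin n → Fin n → Set
  Arc u w = ∃[ i ] nbr u i ≡ w

  StronglyConnected : Set
  StronglyConnected = ∀ u w → Star Arc u w

-- Setting: a rotor graph together with a target set T (as a Boolean
-- predicate; V₀ = {v | T v ≡ false}).
module Rotor (G : RotorGraph) (T : Fin (RotorGraph.n G) → Bool) where
  open RotorGraph G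

  -- rotor configuration: ρ v is the index of the current arc ρ(v) at v ∈ V₀
  RotorConfig : Set
  RotorConfig = (v : Fin n) → T v ≡ false → Fin (d v)

  _≈ᵣ_ : RotorConfig → RotorConfig → Set
  ρ ≈ᵣ ρ' = ∀ v (h : T v ≡ false) → ρ v h ≡ ρ' v h

  -- particle configuration (values on T are irrelevant: particles there never move)
  ParticleConfig : Set
  ParticleConfig = Fin n → ℕ

  State : Set
  State = ParticleConfig × RotorConfig

  advance : RotorConfig → Fin n → RotorConfig
  advance ρ v u h with u ≟ v
  ... | yes _ = next (ρ u h)
  ... | no  _ = ρ u h

  move : ParticleConfig → Fin n → Fin n → ParticleConfig
  move σ v w u with u ≟ v | u ≟ w
  ... | yes _ | yes _ = σ u
  ... | yes _ | no  _ = σ u ∸ 1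
  ... | no  _ | yes _ = suc (σ u)
  ... | no  _ | no  _ = σ u

  data Step : State → State → Set where
    step : ∀ (σ : ParticleConfig) (ρ : RotorConfig) (v : Fin n)
             (h : T v ≡ false) (k : ℕ) → σ v ≡ suc k →
           Step (σ , ρ) (move σ v (nbr v (next (ρ v h))) , advance ρ v)

  Stopped : ParticleConfig → Set
  Stopped σ = ∀ v → T v ≡ false → σ v ≡ 0

  -- Routes σ ρ ρ₁ : placing σ on ρ and letting all particles step until they
  -- reach T yields ρ₁, i.e. ρ₁ = σρ.
  Routes : ParticleConfig → RotorConfig → RotorConfig → Set
  Routes σ ρ ρ₁ = ∃[ σ₁ ] (Star Step (σ , ρ) (σ₁ , ρ₁) × Stopped σ₁)

  _≡ᵣ_ : RotorConfig → RotorConfig → Set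
  ρ ≡ᵣ ρ' = ∃[ σ ] ∃[ ρ₁ ] ∃[ ρ₂ ] (Routes σ ρ ρ₁ × Routes σ ρ' ρ₂ × ρ₁ ≈ᵣ ρ₂)

-- Rotor routing is abelian. Two particle steps at different vertices commute, and adding
-- particles never blocks a step; hence all complete runs from a state end in the same state
-- (away from the targets), and routing σ + τ may be done by routing τ first and then σ.
-- Complete runs exist: particles can be routed one at a time, and a single particle walking in a
-- set A of non-targets keeps returning to a vertex x of A with an arc leaving A (one exists by
-- strong connectivity); each return advances the rotor at x, so after at most d(x) returns the
-- particle leaves A. Hence σ(τρ) = (σ + τ)ρ = τ(σρ), and σρ = σρ' gives
-- σ(τρ) = τ(σρ) = τ(σρ') = σ(τρ').
module Submission where

open import Defs
open import Data.Fin using (Fin)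
open import Data.Bool using (Bool; true)
open import Data.Product using (∃-syntax; _×_)
open import Relation.Binary.PropositionalEquality using (_≡_)

open import Level using (_⊔_)
open import Axiom.UniquenessOfIdentityProofs using (module Decidable⇒UIP)
open import Data.Bool using (false; not) renaming (_≟_ to _≟ᵇ_)
open import Data.Empty using (⊥; ⊥-elim)
open import Data.Fin using (toℕ) renaming (zero to fzero; suc to fsuc)
open import Data.Fin.Properties using (_≟_; toℕ-fromℕ<; toℕ-injective; toℕ<n)
open import Data.Fin.Subset using (Subset; _∈_; _∉_; _-_; _⊂_; ⊤)
open import Data.Fin.Subset.Induction using (⊂-wellFounded; Acc; acc)
open import Data.Fin.Subset.Properties using (_∈?_; nonempty?; ∈⊤; x∈p⇒p-x⊂p; x∈p∧x≢y⇒x∈p-y; p─q⊆p)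
open import Data.Nat using (ℕ; zero; suc; _+_; _∸_; _≤_; _<_; z≤n; s≤s; z<s)
open import Data.Nat.DivMod using (_%_; m<n⇒m%n≡m; n%n≡0)
open import Data.Nat.GeneralisedArithmetic using (iterate)
open import Data.Nat.Properties
  using (+-identityʳ; +-suc; +-comm; m<m+n; ≤-trans; ≤-pred; ≤-reflexive; ≤-refl; <-≤-trans; m+[n∸m]≡n; m∸n+n≡m)
open import Data.Product using (∃₂; _,_; proj₁; proj₂)
open import Data.Sum using (_⊎_; inj₁; inj₂)
open import Data.Vec using (_∷_; tabulate; there)
open import Data.Vec.Properties using (lookup∘tabulate; []=⇒lookup; lookup⇒[]=)
open import Relation.Binary.Core using (Rel)
open import Relation.Binary.Construct.Closure.ReflexiveTransitive using (Star; ε; _◅_; _◅◅_)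
  renaming (map to Star-map)
open import Relation.Binary.PropositionalEquality using (refl; sym; trans; cong; cong₂; subst; _≢_; ≢-sym; module ≡-Reasoning)
open import Relation.Binary.Structures using (IsEquivalence)
open import Relation.Nullary using (¬_; Dec; yes; no)

iterate-+ : ∀ {ℓ} {A : Set ℓ} (f : A → A) x a b → iterate f x (a + b) ≡ iterate f (iterate f x a) b
iterate-+ f x zero    b = refl
iterate-+ f x (suc a) b = iterate-+ f (f x) a b

module _ {m : ℕ} where

  toℕ-next-< : (x : Fin (suc m)) → toℕ x < m → toℕ (next x) ≡ suc (toℕ x)
  toℕ-next-< x x<m = trans (toℕ-fromℕ< _) (m<n⇒m%n≡m (s≤s x<m))

  next-last : (x : Fin (suc m)) → toℕ x ≡ m → next x ≡ fzero
  next-last x x≡m = toℕ-injective (trans (toℕ-fromℕ< _) (trans (cong (λ i → suc i % suc m) x≡m) (n%n≡0 (suc m))))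

  toℕ-iterate-next : ∀ (x : Fin (suc m)) k {j} → toℕ x + k ≡ j → j ≤ m → toℕ (iterate next x k) ≡ j
  toℕ-iterate-next x zero    x+0≡j _   = trans (sym (+-identityʳ (toℕ x))) x+0≡j
  toℕ-iterate-next x (suc k) x+k≡j j≤m =
    toℕ-iterate-next (next x) k (trans (cong (_+ k) next≡) (trans (sym (+-suc (toℕ x) k)) x+k≡j)) j≤m
    where
    next≡ : toℕ (next x) ≡ suc (toℕ x)
    next≡ = toℕ-next-< x (<-≤-trans (m<m+n (toℕ x) z<s) (≤-trans (≤-reflexive x+k≡j) j≤m))

iterate-next-reaches : ∀ {d} (x y : Fin d) → ∃[ k ] iterate next (next x) k ≡ y
iterate-next-reaches {suc m} x y = m ∸ toℕ x + toℕ y , (begin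
  iterate next x (suc (a + toℕ y))        ≡⟨ cong (iterate next x) (+-suc a (toℕ y)) ⟨
  iterate next x (a + suc (toℕ y))        ≡⟨ iterate-+ next x a (suc (toℕ y)) ⟩
  iterate next (next last) (toℕ y)        ≡⟨ cong (λ z → iterate next z (toℕ y)) (next-last last toℕ-last) ⟩
  iterate next fzero (toℕ y)              ≡⟨ toℕ-injective (toℕ-iterate-next fzero (toℕ y) refl (toℕ≤m y)) ⟩
  y                                        ∎)
  where
  open ≡-Reasoning
  toℕ≤m : (z : Fin (suc m)) → toℕ z ≤ m
  toℕ≤m z = ≤-pred (toℕ<n z)
  a = m ∸ toℕ x
  last = iterate next x a
  toℕ-last : toℕ last ≡ m
  toℕ-last = toℕ-iterate-next x a (m+[n∸m]≡n (toℕ≤m x)) ≤-refl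

module StrongConfluence {a r e} {A : Set a} (_⟶_ : Rel A r) (_≈_ : Rel A e)
  (≈-isEquivalence : IsEquivalence _≈_)
  (simulate : ∀ {s s' t} → s ≈ s' → s ⟶ t → ∃[ t' ] s' ⟶ t' × t ≈ t')
  (diamond : ∀ {s s₁ s₂} → s ⟶ s₁ → s ⟶ s₂ →
             s₁ ≈ s₂ ⊎ ∃₂ λ c c' → s₁ ⟶ c × s₂ ⟶ c' × c ≈ c')
  where

  open IsEquivalence ≈-isEquivalence renaming (refl to ≈-refl; sym to ≈-sym; trans to ≈-trans)

  Irreducible : A → Set (a ⊔ r)
  Irreducible s = ∀ {t} → ¬ s ⟶ t

  private
    data Run : ℕ → A → A → Set (a ⊔ r) where
      []  : ∀ {s} → Run 0 s s
      _∷_ : ∀ {m s t u} → s ⟶ t → Run m t u → Run (suc m) s u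

    fromStar : ∀ {s u} → Star _⟶_ s u → ∃[ m ] Run m s u
    fromStar ε          = 0 , []
    fromStar (st ◅ run) with fromStar run
    ... | m , run' = suc m , st ∷ run'

    simulate-run : ∀ {m s s' u} → s ≈ s' → Run m s u → ∃[ u' ] Run m s' u' × u ≈ u'
    simulate-run s≈s' []         = _ , [] , s≈s'
    simulate-run s≈s' (st ∷ run) with simulate s≈s' st
    ... | t' , st' , t≈t' with simulate-run t≈t' run
    ...   | u' , run' , u≈u' = u' , st' ∷ run' , u≈u'

    irreducible-resp : ∀ {s s'} → s ≈ s' → Irreducible s → Irreducible s'
    irreducible-resp s≈s' irr st' with simulate (≈-sym s≈s') st'
    ... | _ , st , _ = irr st

    replace-first-step : ∀ m {s s₁ s₂ u} → s ⟶ s₁ → Run m s₁ u → Irreducible u → s ⟶ s₂ →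
                         ∃[ u' ] Run m s₂ u' × u ≈ u'
    replace-first-step m st₁ run irr st₂ with diamond st₁ st₂
    ... | inj₁ s₁≈s₂ = simulate-run s₁≈s₂ run
    replace-first-step zero    st₁ []          irr st₂ | inj₂ (c , c' , s₁⟶c , s₂⟶c' , c≈c') = ⊥-elim (irr s₁⟶c)
    replace-first-step (suc m) st₁ (st ∷ run) irr st₂ | inj₂ (c , c' , s₁⟶c , s₂⟶c' , c≈c')
      with replace-first-step m st run irr s₁⟶c
    ... | u₁ , run₁ , u≈u₁ with simulate-run c≈c' run₁
    ...   | u₂ , run₂ , u₁≈u₂ = u₂ , s₂⟶c' ∷ run₂ , ≈-trans u≈u₁ u₁≈u₂

    run-unique : ∀ m k {s u u'} → Run m s u → Irreducible u → Run k s u' → Irreducible u' → u ≈ u'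
    run-unique zero    zero    []         _   []           _    = ≈-refl
    run-unique zero    (suc k) []         irr (st ∷ _)     _    = ⊥-elim (irr st)
    run-unique (suc m) zero    (st ∷ _)   _   []           irr' = ⊥-elim (irr' st)
    run-unique (suc m) (suc k) (st ∷ run) irr (st' ∷ run') irr' with replace-first-step m st run irr st'
    ... | u₁ , run₁ , u≈u₁ = ≈-trans u≈u₁ (run-unique m k run₁ (irreducible-resp u≈u₁ irr) run' irr')

  irreducible-unique : ∀ {s u u'} → Star _⟶_ s u → Irreducible u → Star _⟶_ s u' → Irreducible u' → u ≈ u'
  irreducible-unique run irr run' irr' with fromStar run | fromStar run'
  ... | m , r | k , r' = run-unique m k r irr r' irr'

x∉p-x : ∀ {n} (p : Subset n) x → x ∉ p - x
x∉p-x (_ ∷ p) fzero    ()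
x∉p-x (_ ∷ p) (fsuc x) (there x∈p-x) = x∉p-x p x x∈p-x

module _ (G : RotorGraph) where
  open RotorGraph G

  exit-arc : ∀ (A : Subset n) {u w} → Star (Arc G) u w → u ∈ A → w ∉ A → ∃[ x ] ∃[ i ] x ∈ A × nbr x i ∉ A
  exit-arc A ε          u∈A u∉A = ⊥-elim (u∉A u∈A)
  exit-arc A {u} ((i , refl) ◅ path) u∈A w∉A with nbr u i ∈? A
  ... | yes v∈A = exit-arc A path v∈A w∉A
  ... | no v∉A  = u , i , u∈A , v∉A

module RotorRouting (G : RotorGraph) (T : Fin (RotorGraph.n G) → Bool) where
  open RotorGraph G
  open Rotor G T

  target≢nontarget : ∀ {u} → T u ≡ true → T u ≡ false → ⊥
  target≢nontarget T≡true T≡false with trans (sym T≡true) T≡false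
  ... | ()

  advance-self : ∀ ρ {v u} (h : T u ≡ false) → u ≡ v → advance ρ v u h ≡ next (ρ u h)
  advance-self ρ {v} {u} h u≡v with u ≟ v
  ... | yes _   = refl
  ... | no u≢v = ⊥-elim (u≢v u≡v)

  advance-other : ∀ ρ {v u} (h : T u ≡ false) → u ≢ v → advance ρ v u h ≡ ρ u h
  advance-other ρ {v} {u} h u≢v with u ≟ v
  ... | yes u≡v = ⊥-elim (u≢v u≡v)
  ... | no _    = refl

  advance-cong : ∀ {ρ ρ'} v → ρ ≈ᵣ ρ' → advance ρ v ≈ᵣ advance ρ' v
  advance-cong v ρ≈ρ' u h with u ≟ v
  ... | yes _ = cong next (ρ≈ρ' u h)
  ... | no _  = ρ≈ρ' u h

  advance-comm : ∀ ρ {v w} → v ≢ w → advance (advance ρ v) w ≈ᵣ advance (advance ρ w) v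
  advance-comm ρ {v} {w} v≢w u h with u ≟ v | u ≟ w
  ... | yes u≡v | yes u≡w = ⊥-elim (v≢w (trans (sym u≡v) u≡w))
  ... | yes u≡v | no u≢w  = trans (advance-self ρ h u≡v) (sym (cong next (advance-other ρ h u≢w)))
  ... | no u≢v  | yes u≡w = trans (cong next (advance-other ρ h u≢v)) (sym (advance-self ρ h u≡w))
  ... | no u≢v  | no u≢w  = trans (advance-other ρ h u≢v) (sym (advance-other ρ h u≢w))

  -- move with its case analysis exposed, so that nested moves can be split on all four tests at once
  relocate : ∀ {P Q : Set} → Dec P → Dec Q → ℕ → ℕ
  relocate (yes _) (yes _) a = a
  relocate (yes _) (no _)  a = a ∸ 1
  relocate (no _)  (yes _) a = suc a
  relocate (no _)  (no _)  a = a

  move-relocate : ∀ σ v x u → move σ v x u ≡ relocate (u ≟ v) (u ≟ x) (σ u)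
  move-relocate σ v x u with u ≟ v | u ≟ x
  ... | yes _ | yes _ = refl
  ... | yes _ | no _  = refl
  ... | no _  | yes _ = refl
  ... | no _  | no _  = refl

  move-offset : ∀ {σ σ' τ : ParticleConfig} {v k} x u → σ' u ≡ τ u + σ u → σ v ≡ suc k →
                move σ' v x u ≡ τ u + move σ v x u
  move-offset {σ} {σ'} {τ} {v} {k} x u σ'≡ σv≡ with u ≟ v | u ≟ x
  ... | yes _   | yes _ = σ'≡
  ... | yes u≡v | no _  = begin
    σ' u ∸ 1           ≡⟨ cong (_∸ 1) (trans σ'≡ (trans (cong (τ u +_) σu≡) (+-suc (τ u) k))) ⟩
    τ u + k            ≡⟨ cong (λ a → τ u + (a ∸ 1)) σu≡ ⟨
    τ u + (σ u ∸ 1)    ∎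
    where
    open ≡-Reasoning
    σu≡ : σ u ≡ suc k
    σu≡ = trans (cong σ u≡v) σv≡
  ... | no _    | yes _ = trans (cong suc σ'≡) (sym (+-suc (τ u) (σ u)))
  ... | no _    | no _  = σ'≡

  move-keeps-positive : ∀ σ {v w k} x → w ≢ v → σ w ≡ suc k → ∃[ k' ] move σ v x w ≡ suc k'
  move-keeps-positive σ {v} {w} {k} x w≢v σw≡ with w ≟ v | w ≟ x
  ... | yes w≡v | _     = ⊥-elim (w≢v w≡v)
  ... | no _    | yes _ = σ w , refl
  ... | no _    | no _  = k , σw≡

  move-comm : ∀ σ {v w k l} x y u → v ≢ w → σ v ≡ suc k → σ w ≡ suc l →
              move (move σ w y) v x u ≡ move (move σ v x) w y u
  move-comm σ {v} {w} x y u v≢w σv≡ σw≡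
    rewrite move-relocate (move σ w y) v x u | move-relocate σ w y u
          | move-relocate (move σ v x) w y u | move-relocate σ v x u
    with u ≟ v | u ≟ w | u ≟ x | u ≟ y
  ... | yes u≡v | yes u≡w | _     | _     = ⊥-elim (v≢w (trans (sym u≡v) u≡w))
  ... | yes u≡v | no _    | no _  | yes _ rewrite trans (cong σ u≡v) σv≡ = refl
  ... | no _    | yes u≡w | yes _ | no _  rewrite trans (cong σ u≡w) σw≡ = refl
  ... | yes _   | no _    | yes _ | yes _ = refl
  ... | yes _   | no _    | yes _ | no _  = refl
  ... | yes _   | no _    | no _  | no _  = refl
  ... | no _    | yes _   | _     | yes _ = refl
  ... | no _    | yes _   | no _  | no _  = refl
  ... | no _    | no _    | yes _ | yes _ = refl
  ... | no _    | no _    | yes _ | no _  = refl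
  ... | no _    | no _    | no _  | yes _ = refl
  ... | no _    | no _    | no _  | no _  = refl

  Offset : ParticleConfig → State → State → Set
  Offset τ s s' = (∀ u → T u ≡ false → proj₁ s' u ≡ τ u + proj₁ s u) × proj₂ s ≈ᵣ proj₂ s'

  infix 4 _≃_
  _≃_ : State → State → Set
  _≃_ = Offset (λ _ → 0)

  ≃-isEquivalence : IsEquivalence _≃_
  ≃-isEquivalence = record
    { refl  = (λ _ _ → refl) , (λ _ _ → refl)
    ; sym   = λ (σ≡ , ρ≈) → (λ u h → sym (σ≡ u h)) , (λ u h → sym (ρ≈ u h))
    ; trans = λ (σ≡ , ρ≈) (σ≡' , ρ≈') → (λ u h → trans (σ≡' u h) (σ≡ u h)) , (λ u h → trans (ρ≈ u h) (ρ≈' u h))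
    }

  module ≃ = IsEquivalence ≃-isEquivalence

  step-offset : ∀ τ {s s' t} → Offset τ s s' → Step s t → ∃[ t' ] Step s' t' × Offset τ t t'
  step-offset τ {s' = σ' , ρ'} (σ'≡ , ρ≈) (step σ ρ v h k σv≡) =
    _ , step σ' ρ' v h (τ v + k) σ'v≡ , particles , advance-cong v ρ≈
    where
    σ'v≡ : σ' v ≡ suc (τ v + k)
    σ'v≡ = trans (σ'≡ v h) (trans (cong (τ v +_) σv≡) (+-suc (τ v) k))
    particles : ∀ u → T u ≡ false →
                move σ' v (nbr v (next (ρ' v h))) u ≡ τ u + move σ v (nbr v (next (ρ v h))) u
    particles u hu rewrite ρ≈ v h = move-offset {τ = τ} _ u (σ'≡ u hu) σv≡

  offset-star : ∀ τ {s s' t} → Offset τ s s' → Star Step s t → ∃[ t' ] Star Step s' t' × Offset τ t t'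
  offset-star τ off ε = _ , ε , off
  offset-star τ off (st ◅ run) with step-offset τ off st
  ... | _ , st' , off' with offset-star τ off' run
  ...   | t' , run' , off'' = t' , st' ◅ run' , off''

  stopped-resp : ∀ {s s'} → s ≃ s' → Stopped (proj₁ s) → Stopped (proj₁ s')
  stopped-resp (σ≡ , _) stop u h = trans (σ≡ u h) (stop u h)

  step-diamond : ∀ {s s₁ s₂} → Step s s₁ → Step s s₂ →
                 s₁ ≃ s₂ ⊎ ∃₂ λ c c' → Step s₁ c × Step s₂ c' × c ≃ c'
  step-diamond (step σ ρ v h _ σv≡) (step .σ .ρ w h' _ σw≡) with v ≟ w
  ... | yes refl rewrite Decidable⇒UIP.≡-irrelevant _≟ᵇ_ h h' = inj₁ ≃.refl
  ... | no v≢w =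
    inj₂ (_ , _ , step _ _ w h' _ (proj₂ σ₁w>0) , step _ _ v h _ (proj₂ σ₂v>0) , particles , advance-comm ρ v≢w)
    where
    x = nbr v (next (ρ v h))
    y = nbr w (next (ρ w h'))
    σ₁w>0 = move-keeps-positive σ x (≢-sym v≢w) σw≡
    σ₂v>0 = move-keeps-positive σ y v≢w σv≡
    particles : ∀ u → T u ≡ false →
      move (move σ w y) v (nbr v (next (advance ρ w v h))) u ≡ move (move σ v x) w (nbr w (next (advance ρ v w h'))) u
    particles u _ rewrite advance-other ρ h v≢w | advance-other ρ h' (≢-sym v≢w) = move-comm σ x y u v≢w σv≡ σw≡

  open StrongConfluence Step _≃_ ≃-isEquivalence (step-offset (λ _ → 0)) step-diamond

  stopped-irreducible : ∀ {s} → Stopped (proj₁ s) → Irreducible s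
  stopped-irreducible stop (step _ _ v h _ σv≡) with trans (sym (stop v h)) σv≡
  ... | ()

  stopped-unique : ∀ {s a b} → Star Step s a → Stopped (proj₁ a) → Star Step s b → Stopped (proj₁ b) → a ≃ b
  stopped-unique run stop run' stop' = irreducible-unique run (stopped-irreducible stop) run' (stopped-irreducible stop')

  routes-unique : ∀ {σ σ' ρ ρ' ρ₁ ρ₂} → (σ , ρ) ≃ (σ' , ρ') → Routes σ ρ ρ₁ → Routes σ' ρ' ρ₂ → ρ₁ ≈ᵣ ρ₂
  routes-unique s≃s' (_ , run , stop) (_ , run' , stop') with offset-star (λ _ → 0) s≃s' run
  ... | _ , run'' , t≃t' = proj₂ (≃.trans t≃t' (stopped-unique run'' (stopped-resp t≃t' stop) run' stop'))

  routes-sequential : ∀ {σ τ π ρ ρ₁ ρ₂ ρ₃} → (∀ u → T u ≡ false → π u ≡ σ u + τ u) →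
                      Routes τ ρ ρ₁ → Routes σ ρ₁ ρ₂ → Routes π ρ ρ₃ → ρ₂ ≈ᵣ ρ₃
  routes-sequential {σ} π≡ (_ , runτ , stopτ) (_ , runσ , stopσ) (_ , runπ , stopπ)
    with offset-star σ (π≡ , λ _ _ → refl) runτ
  ... | _ , run₁ , τ₁≡ , ρ₁≈ with offset-star (λ _ → 0) (lifted≃ , ρ₁≈) runσ
    where
    lifted≃ = λ u hu → trans (τ₁≡ u hu) (trans (cong (σ u +_) (stopτ u hu)) (+-identityʳ (σ u)))
  ...   | _ , run₂ , t≃t' = proj₂ (≃.trans t≃t' (stopped-unique (run₁ ◅◅ run₂) (stopped-resp t≃t' stopσ) runπ stopπ))

  data Hop (A : Subset n) : Fin n × RotorConfig → Fin n × RotorConfig → Set where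
    hop : ∀ {u} ρ → u ∈ A → (h : T u ≡ false) → Hop A (u , ρ) (nbr u (next (ρ u h)) , advance ρ u)

  Escapes : Subset n → Fin n × RotorConfig → Set
  Escapes A p = ∃[ q ] Star (Hop A) p q × proj₁ q ∉ A

  hops-mono : ∀ {A B} → (∀ {u} → u ∈ A → u ∈ B) → ∀ {p q} → Star (Hop A) p q → Star (Hop B) p q
  hops-mono A⊆B = Star-map λ { (hop ρ u∈A h) → hop ρ (A⊆B u∈A) h }

  hops-fix-rotor : ∀ {A x p q} → Star (Hop A) p q → x ∉ A → (h : T x ≡ false) → proj₂ q x h ≡ proj₂ p x h
  hops-fix-rotor ε                    x∉A h = refl
  hops-fix-rotor (hop ρ u∈A _ ◅ hops) x∉A h =
    trans (hops-fix-rotor hops x∉A h) (advance-other ρ h λ { refl → x∉A u∈A })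

  V₀ : Subset n
  V₀ = tabulate (λ u → not (T u))

  V₀-nontarget : ∀ {u} → u ∈ V₀ → T u ≡ false
  V₀-nontarget {u} u∈V₀ with T u | trans (sym ([]=⇒lookup u∈V₀)) (lookup∘tabulate (λ u → not (T u)) u)
  ... | false | _  = refl
  ... | true  | ()

  V₀-target : ∀ {u} → u ∉ V₀ → T u ≡ true
  V₀-target {u} u∉V₀ with T u in Tu
  ... | true  = refl
  ... | false = ⊥-elim (u∉V₀ (lookup⇒[]= u V₀ (trans (lookup∘tabulate (λ u → not (T u)) u) (cong not Tu))))

  𝟙 : Fin n → ParticleConfig
  𝟙 v u with u ≟ v
  ... | yes _ = 1
  ... | no _  = 0

  𝟙-self : ∀ {v u} → u ≡ v → 𝟙 v u ≡ 1
  𝟙-self {v} {u} u≡v with u ≟ v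
  ... | yes _   = refl
  ... | no u≢v = ⊥-elim (u≢v u≡v)

  𝟙-other : ∀ {v u} → u ≢ v → 𝟙 v u ≡ 0
  𝟙-other {v} {u} u≢v with u ≟ v
  ... | yes u≡v = ⊥-elim (u≢v u≡v)
  ... | no _    = refl

  move-𝟙 : ∀ v x u → move (𝟙 v) v x u ≡ 𝟙 x u
  move-𝟙 v x u with u ≟ v | u ≟ x
  ... | yes u≡v | yes _   = 𝟙-self u≡v
  ... | yes u≡v | no _    = cong (_∸ 1) (𝟙-self u≡v)
  ... | no u≢v  | yes _   = cong suc (𝟙-other u≢v)
  ... | no u≢v  | no _    = 𝟙-other u≢v

  hop-lift : ∀ π {A p q s} → Hop A p q → Offset π (𝟙 (proj₁ p) , proj₂ p) s →
             ∃[ s' ] Step s s' × Offset π (𝟙 (proj₁ q) , proj₂ q) s'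
  hop-lift π (hop {u} ρ _ h) off with step-offset π off (step (𝟙 u) ρ u h 0 (𝟙-self refl))
  ... | s' , st , σ'≡ , ρ≈ = s' , st , (λ w hw → trans (σ'≡ w hw) (cong (π w +_) (move-𝟙 u _ w))) , ρ≈

  hops-lift : ∀ π {A p q s} → Star (Hop A) p q → Offset π (𝟙 (proj₁ p) , proj₂ p) s →
              ∃[ s' ] Star Step s s' × Offset π (𝟙 (proj₁ q) , proj₂ q) s'
  hops-lift π ε            off = _ , ε , off
  hops-lift π (h ◅ hops) off with hop-lift π h off
  ... | _ , st , off' with hops-lift π hops off'
  ...   | s' , run , off'' = s' , st ◅ run , off''

  infixl 6 _⊕_ _⊖_
  _⊕_ _⊖_ : ParticleConfig → ParticleConfig → ParticleConfig
  (σ ⊕ π) u = σ u + π u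
  (σ ⊖ π) u = σ u ∸ π u

  𝟙≤ : ∀ {σ v k} → σ v ≡ suc k → ∀ u → 𝟙 v u ≤ σ u
  𝟙≤ {σ} {v} σv≡ u with u ≟ v
  ... | yes u≡v = subst (1 ≤_) (sym (trans (cong σ u≡v) σv≡)) (s≤s z≤n)
  ... | no _    = z≤n

  module Termination (sc : StronglyConnected G) {t} (t∈T : T t ≡ true) where

    escapes : ∀ A → Acc _⊂_ A → (∀ {u} → u ∈ A → T u ≡ false) → ∀ u ρ → Escapes A (u , ρ)
    escapes A (acc rec) A⊆V₀ u ρ with u ∈? A
    ... | no u∉A  = (u , ρ) , ε , u∉A
    ... | yes u∈A with exit-arc G A (sc u t) u∈A (λ t∈A → target≢nontarget t∈T (A⊆V₀ t∈A))
    ...   | x , i₀ , x∈A , exit∉A = visits (proj₁ reach) ρ (proj₂ reach) u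
      where
      hx = A⊆V₀ x∈A
      reach = iterate-next-reaches (ρ x hx) i₀
      escapes-A-x = escapes (A - x) (rec (x∈p⇒p-x⊂p x∈A)) (λ u∈A-x → A⊆V₀ (p─q⊆p A _ u∈A-x))

      -- Walks in A - x leave the rotor at x alone, so each return to x advances it by one;
      -- after k + 1 returns it points along the exit arc.
      visits : ∀ k ρ → iterate next (next (ρ x hx)) k ≡ i₀ → ∀ u → Escapes A (u , ρ)
      visits k ρ cycle u with escapes-A-x u ρ
      ... | (w , ρ₁) , hops , w∉A-x with w ≟ x
      ...   | no w≢x   = (w , ρ₁) , hops-mono (p─q⊆p A _) hops , λ w∈A → w∉A-x (x∈p∧x≢y⇒x∈p-y w∈A w≢x)
      ...   | yes refl = fire-x k cycle
        where
        ρ₁x≡ρx : ρ₁ x hx ≡ ρ x hx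
        ρ₁x≡ρx = hops-fix-rotor hops (x∉p-x A x) hx
        hops⁺ = hops-mono (p─q⊆p A _) hops ◅◅ (hop ρ₁ x∈A hx ◅ ε)
        fire-x : ∀ k → iterate next (next (ρ x hx)) k ≡ i₀ → Escapes A (u , ρ)
        fire-x zero    cycle = _ , hops⁺ , subst (λ j → nbr x j ∉ A) (sym (trans (cong next ρ₁x≡ρx) cycle)) exit∉A
        fire-x (suc k) cycle with visits k (advance ρ₁ x) cycle' (nbr x (next (ρ₁ x hx)))
          where
          cycle' : iterate next (next (advance ρ₁ x x hx)) k ≡ i₀
          cycle' = subst (λ j → iterate next (next j) k ≡ i₀) (sym (trans (advance-self ρ₁ hx refl) (cong next ρ₁x≡ρx))) cycle
        ... | q , hops' , q∉A = q , hops⁺ ◅◅ hops' , q∉A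

    Terminates : State → Set
    Terminates s = ∃[ s' ] Star Step s s' × Stopped (proj₁ s')

    route-one-particle : ∀ σ {v k} ρ → σ v ≡ suc k →
                         (∀ ρ' → Terminates (σ ⊖ 𝟙 v , ρ')) → Terminates (σ , ρ)
    route-one-particle σ {v} ρ σv≡ rest with escapes V₀ (⊂-wellFounded V₀) V₀-nontarget v ρ
    ... | (w , ρ₁) , hops , w∉V₀ with hops-lift (σ ⊖ 𝟙 v) hops ((λ u _ → sym (m∸n+n≡m (𝟙≤ σv≡ u))) , λ _ _ → refl)
    ...   | s' , run , σ'≡ , ρ≈ with rest ρ₁
    ...     | a , run' , stop with offset-star (λ _ → 0) (s'≃ , ρ≈) run'
      where
      s'≃ : ∀ u → T u ≡ false → proj₁ s' u ≡ (σ ⊖ 𝟙 v) u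
      s'≃ u hu = trans (σ'≡ u hu) (trans (cong ((σ ⊖ 𝟙 v) u +_) (𝟙-other λ { refl → target≢nontarget (V₀-target w∉V₀) hu }))
                                         (+-identityʳ _))
    ...       | a' , run'' , a≃a' = a' , run ◅◅ run'' , stopped-resp a≃a' stop

    SupportedIn : Subset n → ParticleConfig → Set
    SupportedIn B σ = ∀ u → T u ≡ false → u ∉ B → σ u ≡ 0

    terminates-supported : ∀ B → Acc _⊂_ B → ∀ σ → SupportedIn B σ → ∀ ρ → Terminates (σ , ρ)
    terminates-supported B (acc rec) σ supp ρ with nonempty? B
    ... | no empty       = (σ , ρ) , ε , λ u hu → supp u hu (λ u∈B → empty (u , u∈B))
    ... | yes (v , v∈B) = drain (σ v) σ refl supp ρ
      where
      shrink : ∀ {σ} → σ v ≡ 0 → SupportedIn B σ → SupportedIn (B - v) σ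
      shrink σv≡0 supp u hu u∉B-v with u ≟ v
      ... | yes refl = σv≡0
      ... | no u≢v   = supp u hu (λ u∈B → u∉B-v (x∈p∧x≢y⇒x∈p-y u∈B u≢v))

      drain : ∀ k σ → σ v ≡ k → SupportedIn B σ → ∀ ρ → Terminates (σ , ρ)
      drain zero    σ σv≡0 supp = terminates-supported (B - v) (rec (x∈p⇒p-x⊂p v∈B)) σ (shrink σv≡0 supp)
      drain (suc k) σ σv≡  supp ρ =
        route-one-particle σ ρ σv≡ (drain k (σ ⊖ 𝟙 v) (cong₂ _∸_ σv≡ (𝟙-self {v} refl)) supp⁻)
        where
        supp⁻ : SupportedIn B (σ ⊖ 𝟙 v)
        supp⁻ u hu u∉B = trans (cong (σ u ∸_) (𝟙-other {v} {u} λ { refl → u∉B v∈B })) (supp u hu u∉B)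

    terminates : ∀ s → Terminates s
    terminates (σ , ρ) = terminates-supported ⊤ (⊂-wellFounded ⊤) σ (λ _ _ u∉⊤ → ⊥-elim (u∉⊤ ∈⊤)) ρ

    routes : ∀ σ ρ → ∃[ ρ₁ ] Routes σ ρ ρ₁
    routes σ ρ with terminates (σ , ρ)
    ... | (σ₁ , ρ₁) , run , stop = ρ₁ , σ₁ , run , stop

    routes-comm : ∀ {σ τ ρ ρ₁ ρ₂ X Z} → Routes τ ρ ρ₁ → Routes σ ρ₁ X → Routes σ ρ ρ₂ → Routes τ ρ₂ Z → X ≈ᵣ Z
    routes-comm {σ} {τ} {ρ} Rτ RX Rσ RZ with routes (σ ⊕ τ) ρ
    ... | _ , R⊕ = λ u h → trans (routes-sequential (λ _ _ → refl) Rτ RX R⊕ u h)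
                                 (sym (routes-sequential (λ u _ → +-comm (σ u) (τ u)) Rσ RZ R⊕ u h))

lemma3p2 : (G : RotorGraph) → StronglyConnected G →
    (T : Fin (RotorGraph.n G) → Bool) → ∃[ t ] T t ≡ true →
    let open Rotor G T in
    (ρ ρ' : RotorConfig) → ρ ≡ᵣ ρ' →
    (τ : ParticleConfig) →
    ∃[ ρ₁ ] ∃[ ρ₁' ] (Routes τ ρ ρ₁ × Routes τ ρ' ρ₁' × ρ₁ ≡ᵣ ρ₁')
lemma3p2 G sc T (t , t∈T) ρ ρ' (σ , σρ , σρ' , Rσρ , Rσρ' , σρ≈σρ') τ =
  let open RotorRouting G T
      open Termination sc t∈T
      τρ   , Rτρ   = routes τ ρ
      τρ'  , Rτρ'  = routes τ ρ'
      στρ  , Rστρ  = routes σ τρ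
      στρ' , Rστρ' = routes σ τρ'
      τσρ  , Rτσρ  = routes τ σρ
      τσρ' , Rτσρ' = routes τ σρ'
      στρ≈τσρ   = routes-comm Rτρ Rστρ Rσρ Rτσρ
      στρ'≈τσρ' = routes-comm Rτρ' Rστρ' Rσρ' Rτσρ'
      τσρ≈τσρ'  = routes-unique ((λ _ _ → refl) , σρ≈σρ') Rτσρ Rτσρ'
  in τρ , τρ' , Rτρ , Rτρ' , σ , στρ , στρ' , Rστρ , Rστρ' ,
     λ u h → trans (στρ≈τσρ u h) (trans (τσρ≈τσρ' u h) (sym (στρ'≈τσρ' u h)))
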